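{- Let $x=\lim_{k\to\infty}\varphi^{2k}(b.a)\in\{a,b\}^\mathbb{Z}$ and let $n\in\mathbb{Z}\setminus I_0$. Then there exist integers $m\in\mathbb{Z}$ and $0\le\ell<3$ such that $x_n=\varphi^2(x_m)[\ell]$ and $\operatorname{rep}_\mathcal{F}(n)=\operatorname{rep}_\mathcal{F}(m)\,h(\ell)$. Moreover, if $n\in I_i\setminus I_{i-1}$ for some integer $i\ge1$, then $m\in I_{i-1}\setminus I_{i-2}$.
   Context: $\varphi$ is the morphism $a\mapsto ab$, $b\mapsto a$. The bi-infinite word $x=(x_n)_{n\in\mathbb{Z}}$ is defined by: for every $k\ge0$, $x_{ -|\varphi^{2k}(b)|}\cdots x_{ -1}=\varphi^{2k}(b)$ and $x_0\cdots x_{|\varphi^{2k}(a)|-1}=\varphi^{2k}(a)$. For a finite word $u=u_0u_1\cdots$, $u[\ell]=u_\ell$. $h$ is the morphism $\{0,1,2\}^*\to\{0,1\}^*$ given by $0\mapsto00$, $1\mapsto01$, $2\mapsto10$. Fibonacci numbers: $F_0=1$, $F_1=1$, $F_{n+2}=F_{n+1}+F_n$ for $n\ge0$. $I_k=\{i\in\mathbb{Z}:-F_{2k}\le i<F_{2k+1}\}$ for $k\ge0$, $I_{ -1}=\varnothing$ (so $I_0=\{ -1,0\}$). For an odd-length binary word $w=w_{2k+1}\cdots w_1$ (indexed right to left), $\operatorname{val}_\mathcal{F}(w)=\sum_{i=1}^{2k}w_iF_i-w_{2k+1}F_{2k}$; $\operatorname{rep}_\mathcal{F}(n)$ is the unique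 odd-length binary word with no factor $11$, not beginning with $000$ or $101$, with value $n$. -}

module Defs where

open import Data.Nat using (ℕ; zero; suc; _*_)
import Data.Nat as ℕ
open import Data.Integer using (ℤ; +_; _-_; _≤_; _<_)
import Data.Integer as ℤ
open import Data.List using (List; []; _∷_; _++_; concatMap; length; lookup)
open import Data.Fin using (Fin; toℕ)
open import Data.Product using (_×_)
open import Data.Empty using (⊥)
open import Data.Unit using (⊤)
open import Relation.Nullary using (¬_)
open import Relation.Binary.PropositionalEquality using (_≡_)
open import Function using (_∘_)

data Letter : Set where
  a b : Letter

φ₁ : Letter → List Letter
φ₁ a = a ∷ b ∷ []
φ₁ b = a ∷ []

φ : List Letter → List Letter
φ = concatMap φ₁

φ^ : ℕ → List Letter → List Letter
φ^ zero w = w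
φ^ (suc n) w = φ (φ^ n w)

φ²ₗ : Letter → List Letter
φ²ₗ c = φ^ 2 (c ∷ [])

-- The defining property of the bi-infinite word x = lim φ^{2k}(b.a):
-- for every k ≥ 0, x_{-|φ^{2k}(b)|} ⋯ x_{-1} = φ^{2k}(b) and
-- x_0 ⋯ x_{|φ^{2k}(a)|-1} = φ^{2k}(a).
IsFixedWord : (ℤ → Letter) → Set
IsFixedWord x =
  (k : ℕ) →
    ((i : Fin (length (φ^ (2 * k) (b ∷ []))))
       → x (+ toℕ i - + length (φ^ (2 * k) (b ∷ []))) ≡ lookup (φ^ (2 * k) (b ∷ [])) i)
  × ((i : Fin (length (φ^ (2 * k) (a ∷ []))))
       → x (+ toℕ i) ≡ lookup (φ^ (2 * k) (a ∷ [])) i)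

open import Data.Maybe using (Maybe; just; nothing) public

_[_] : {A : Set} → List A → ℕ → Maybe A
[] [ _ ] = nothing
(c ∷ u) [ zero ] = just c
(c ∷ u) [ suc ℓ ] = u [ ℓ ]

F : ℕ → ℕ
F zero = 1
F (suc zero) = 1
F (suc (suc n)) = F (suc n) ℕ.+ F n

InI : ℕ → ℤ → Set
InI k i = (ℤ.- (+ F (2 * k)) ≤ i) × (i < + F (suc (2 * k)))

InIpred : ℕ → ℤ → Set
InIpred zero i = ⊥
InIpred (suc k) i = InI k i

data Bit : Set where
  𝟎 𝟏 : Bit

bitℕ : Bit → ℕ
bitℕ 𝟎 = 0
bitℕ 𝟏 = 1

h : Fin 3 → List Bit
h Fin.zero = 𝟎 ∷ 𝟎 ∷ []
h (Fin.suc Fin.zero) = 𝟎 ∷ 𝟏 ∷ []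
h (Fin.suc (Fin.suc Fin.zero)) = 𝟏 ∷ 𝟎 ∷ []

-- For a word w_j ⋯ w_1 (written left to right, index = position from the right),
-- Σ_{i=1}^{j} w_i F_i
valLow : List Bit → ℕ
valLow [] = 0
valLow (c ∷ u) = bitℕ c * F (suc (length u)) ℕ.+ valLow u

-- val_F(w_{2k+1} ⋯ w_1) = Σ_{i=1}^{2k} w_i F_i − w_{2k+1} F_{2k}
-- (the empty word is given value 0; it is never an odd-length word)
valF : List Bit → ℤ
valF [] = + 0
valF (c ∷ u) = + valLow u - + (bitℕ c * F (length u))

Odd : ℕ → Set
Odd zero = ⊥
Odd (suc zero) = ⊤
Odd (suc (suc n)) = Odd n

No11 : List Bit → Set
No11 [] = ⊤
No11 (𝟏 ∷ 𝟏 ∷ u) = ⊥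
No11 (c ∷ u) = No11 u

BeginsWith : List Bit → List Bit → Set
BeginsWith p w = Data.Product.Σ (List Bit) (λ r → w ≡ p ++ r)
  where import Data.Product

-- w = rep_F(n): w is the (unique) odd-length binary word with no factor 11,
-- not beginning with 000 or 101, whose value is n.
IsRepF : List Bit → ℤ → Set
IsRepF w n =
  Odd (length w) × No11 w
  × ¬ BeginsWith (𝟎 ∷ 𝟎 ∷ 𝟎 ∷ []) w
  × ¬ BeginsWith (𝟏 ∷ 𝟎 ∷ 𝟏 ∷ []) w
  × valF w ≡ n

-- Read a word u without factor 11 as a Zeckendorf numeral: position valLow u of φ^|u|(a) carries
-- the letter of the last digit of u (𝟎 ↦ a, 𝟏 ↦ b). As the even powers φ^2k(b).φ^2k(a) are
-- read off x around the origin, x at val_F(w) is the letter of the last digit of w. Splitting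
-- rep_F(n) = v · d₁d₂, the word v is rep_F(m) for m = val_F(v), and x_n is the letter of d₂,
-- which is position ℓ of φ²(x_m) because φ²(c) starts with ab for both letters and the suffix 10
-- forces v to end with 𝟎. A representation of length 2k+1 has its value in I_k ∖ I_{k-1}, so
-- removing two digits lowers the level by one. Representations of n ∉ I₀ come from the greedy
-- Zeckendorf expansion, behind a leading 𝟎 for n > 0 and a leading 𝟏𝟎𝟎 for n < -1.

module Submission where

open import Defs
open import Data.Nat using (ℕ)
open import Data.Integer using (ℤ)
open import Data.Fin using (Fin; toℕ)
open import Data.List using (List; _++_)
open import Data.Maybe using (just)
open import Data.Product using (Σ; _×_)
open import Relation.Nullary using (¬_)
open import Relation.Binary.PropositionalEquality using (_≡_)

open import Data.Nat using (zero; suc; _+_; _*_; _∸_; _≤_; _<_; z≤n; s≤s; _≤?_; _<?_; >-nonZero)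
open import Data.Nat.Properties
open import Data.Integer as ℤ using (+_; -[1+_]; -_; _⊖_; +<+; -≤-; -<+)
import Data.Integer.Properties as ℤ
open import Data.Fin using (zero; suc)
open import Data.List using ([]; _∷_; length; lookup)
open import Data.List.Properties using (concatMap-++; length-++; ++-assoc)
open import Data.Product using (_,_; proj₁; proj₂)
open import Data.Sum using (inj₁; inj₂)
open import Data.Empty using (⊥-elim)
open import Data.Unit using (tt)
open import Relation.Nullary using (yes; no)
open import Relation.Binary.Definitions using (tri<; tri≈; tri>)
open import Relation.Binary.PropositionalEquality
  using (refl; sym; trans; cong; cong₂; subst; subst₂; module ≡-Reasoning)
open import Function using (_∘_)

[]≡just⇒lookup : {A : Set} (xs : List A) (t : ℕ) {c : A} → xs [ t ] ≡ just c →
  Σ (Fin (length xs)) λ i → toℕ i ≡ t × lookup xs i ≡ c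
[]≡just⇒lookup (y ∷ ys) zero refl = zero , refl , refl
[]≡just⇒lookup (y ∷ ys) (suc t) eq with []≡just⇒lookup ys t eq
... | i , refl , yᵢ≡c = suc i , refl , yᵢ≡c

[]-++ˡ : {A : Set} (xs ys : List A) {t : ℕ} → t < length xs → (xs ++ ys) [ t ] ≡ xs [ t ]
[]-++ˡ (x ∷ xs) ys {zero} _ = refl
[]-++ˡ (x ∷ xs) ys {suc t} (s≤s t<) = []-++ˡ xs ys t<

[]-++ʳ : {A : Set} (xs ys : List A) (t : ℕ) → (xs ++ ys) [ length xs + t ] ≡ ys [ t ]
[]-++ʳ [] ys t = refl
[]-++ʳ (x ∷ xs) ys t = []-++ʳ xs ys t

φ^-++ : (n : ℕ) (u w : List Letter) → φ^ n (u ++ w) ≡ φ^ n u ++ φ^ n w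
φ^-++ zero u w = refl
φ^-++ (suc n) u w = trans (cong φ (φ^-++ n u w)) (concatMap-++ φ₁ (φ^ n u) (φ^ n w))

φ^-φ : (n : ℕ) (w : List Letter) → φ^ n (φ w) ≡ φ (φ^ n w)
φ^-φ zero w = refl
φ^-φ (suc n) w = cong φ (φ^-φ n w)

φ^-suc-a : (j : ℕ) → φ^ (suc j) (a ∷ []) ≡ φ^ j (a ∷ []) ++ φ^ j (b ∷ [])
φ^-suc-a j = trans (sym (φ^-φ j (a ∷ []))) (φ^-++ j (a ∷ []) (b ∷ []))

φ^-suc-b : (j : ℕ) → φ^ (suc j) (b ∷ []) ≡ φ^ j (a ∷ [])
φ^-suc-b j = sym (φ^-φ j (b ∷ []))

length-φ^-a : (j : ℕ) → length (φ^ j (a ∷ [])) ≡ F (suc j)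
length-φ^-b : (j : ℕ) → length (φ^ j (b ∷ [])) ≡ F j
length-φ^-a zero = refl
length-φ^-a (suc j) = begin
  length (φ^ (suc j) (a ∷ []))                   ≡⟨ cong length (φ^-suc-a j) ⟩
  length (φ^ j (a ∷ []) ++ φ^ j (b ∷ []))        ≡⟨ length-++ (φ^ j (a ∷ [])) ⟩
  length (φ^ j (a ∷ [])) + length (φ^ j (b ∷ [])) ≡⟨ cong₂ _+_ (length-φ^-a j) (length-φ^-b j) ⟩
  F (suc (suc j))                                 ∎
  where open ≡-Reasoning
length-φ^-b zero = refl
length-φ^-b (suc j) = trans (cong length (φ^-suc-b j)) (length-φ^-a j)

F-pos : (n : ℕ) → 0 < F n
F-pos zero = s≤s z≤n
F-pos (suc zero) = s≤s z≤n
F-pos (suc (suc n)) = ≤-trans (F-pos (suc n)) (m≤m+n _ _)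

F-≤-suc : (n : ℕ) → F n ≤ F (suc n)
F-≤-suc zero = ≤-refl
F-≤-suc (suc n) = m≤m+n _ _

F-mono-≤ : {i j : ℕ} → i ≤ j → F i ≤ F j
F-mono-≤ {j = zero} z≤n = ≤-refl
F-mono-≤ {i} {suc j} i≤1+j with m≤n⇒m<n∨m≡n i≤1+j
... | inj₁ (s≤s i≤j) = ≤-trans (F-mono-≤ i≤j) (F-≤-suc j)
... | inj₂ refl = ≤-refl

F-<-2+ : (n : ℕ) → F n < F (2 + n)
F-<-2+ n = +-monoˡ-≤ (F n) (F-pos (suc n))

F-2*-<-odd : (k : ℕ) → F (1 + 2 * k) < F (1 + 2 * suc k)
F-2*-<-odd k = subst (λ j → F (1 + 2 * k) < F (suc j)) (sym (*-suc 2 k)) (F-<-2+ (1 + 2 * k))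

F-2*-<-even : (k : ℕ) → F (2 * k) < F (2 * suc k)
F-2*-<-even k = subst (λ j → F (2 * k) < F j) (sym (*-suc 2 k)) (F-<-2+ (2 * k))

bracket : (g : ℕ → ℕ) → (∀ k → g k < g (suc k)) → (p : ℕ) → g 0 ≤ p →
  Σ ℕ λ k → g k ≤ p × p < g (suc k)
bracket g g↑ zero g₀≤0 = 0 , g₀≤0 , ≤-<-trans z≤n (g↑ 0)
bracket g g↑ (suc p) g₀≤1+p with g 0 ≤? p
... | no g₀≰p = 0 , g₀≤1+p , ≤-<-trans (≰⇒> g₀≰p) (g↑ 0)
... | yes g₀≤p with bracket g g↑ p g₀≤p
...   | k , gₖ≤p , p<gₖ₊₁ with suc p <? g (suc k)
...     | yes 1+p<gₖ₊₁ = k , m≤n⇒m≤1+n gₖ≤p , 1+p<gₖ₊₁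
...     | no 1+p≮gₖ₊₁ = suc k , ≮⇒≥ 1+p≮gₖ₊₁ , ≤-<-trans p<gₖ₊₁ (g↑ (suc k))

odd-1+2* : (k : ℕ) → Odd (1 + 2 * k)
odd-1+2* zero = tt
odd-1+2* (suc k) = subst (λ j → Odd (suc j)) (sym (*-suc 2 k)) (odd-1+2* k)

odd⇒1+2* : (n : ℕ) → Odd n → Σ ℕ λ k → n ≡ 1 + 2 * k
odd⇒1+2* (suc zero) _ = 0 , refl
odd⇒1+2* (suc (suc n)) odd with odd⇒1+2* n odd
... | k , refl = suc k , cong suc (sym (*-suc 2 k))

letter : Bit → Letter
letter 𝟎 = a
letter 𝟏 = b

-- The last bit of a word; the empty word is given 𝟎, so that prepending 𝟎 never changes it.
lastBit : List Bit → Bit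
lastBit [] = 𝟎
lastBit (c ∷ []) = c
lastBit (_ ∷ d ∷ u) = lastBit (d ∷ u)

lastBit-𝟎∷ : (u : List Bit) → lastBit (𝟎 ∷ u) ≡ lastBit u
lastBit-𝟎∷ [] = refl
lastBit-𝟎∷ (_ ∷ _) = refl

lastBit-++ : (v : List Bit) (c d : Bit) → lastBit (v ++ c ∷ d ∷ []) ≡ d
lastBit-++ [] c d = refl
lastBit-++ (_ ∷ []) c d = refl
lastBit-++ (_ ∷ e ∷ v) c d = lastBit-++ (e ∷ v) c d

No11-tail : (c : Bit) (u : List Bit) → No11 (c ∷ u) → No11 u
No11-tail 𝟎 u nu = nu
No11-tail 𝟏 [] _ = tt
No11-tail 𝟏 (𝟎 ∷ u) nu = nu

No11-++⁻ˡ : (v s : List Bit) → No11 (v ++ s) → No11 v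
No11-++⁻ˡ [] s _ = tt
No11-++⁻ˡ (𝟎 ∷ v) s nvs = No11-++⁻ˡ v s nvs
No11-++⁻ˡ (𝟏 ∷ []) s _ = tt
No11-++⁻ˡ (𝟏 ∷ 𝟎 ∷ v) s nvs = No11-++⁻ˡ (𝟎 ∷ v) s nvs

No11⇒lastBit≡𝟎 : (v r : List Bit) → No11 (v ++ 𝟏 ∷ r) → lastBit v ≡ 𝟎
No11⇒lastBit≡𝟎 [] r _ = refl
No11⇒lastBit≡𝟎 (𝟎 ∷ []) r _ = refl
No11⇒lastBit≡𝟎 (c ∷ d ∷ v) r nw = No11⇒lastBit≡𝟎 (d ∷ v) r (No11-tail c _ nw)

valLow-𝟏 : (u : List Bit) → valLow (𝟏 ∷ u) ≡ F (suc (length u)) + valLow u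
valLow-𝟏 u = cong (_+ valLow u) (*-identityˡ (F (suc (length u))))

valLow<F : (u : List Bit) → No11 u → valLow u < F (suc (length u))
valLow<F [] _ = s≤s z≤n
valLow<F (𝟎 ∷ u) nu = ≤-trans (valLow<F u nu) (m≤m+n _ _)
valLow<F (𝟏 ∷ []) _ = s≤s (s≤s z≤n)
valLow<F (𝟏 ∷ 𝟎 ∷ u) nu =
  subst (_< F (3 + length u)) (sym (valLow-𝟏 (𝟎 ∷ u))) (+-monoʳ-< (F (2 + length u)) (valLow<F u nu))

F≤valLow : (c d : Bit) (r : List Bit) → ¬ BeginsWith (𝟎 ∷ 𝟎 ∷ 𝟎 ∷ []) (𝟎 ∷ c ∷ d ∷ r) →
  F (suc (length r)) ≤ valLow (c ∷ d ∷ r)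
F≤valLow 𝟎 𝟎 r ¬000 = ⊥-elim (¬000 (r , refl))
F≤valLow 𝟎 𝟏 r _ = subst (F (suc (length r)) ≤_) (sym (valLow-𝟏 r)) (m≤m+n _ (valLow r))
F≤valLow 𝟏 d r _ = subst (F (suc (length r)) ≤_) (sym (valLow-𝟏 (d ∷ r)))
  (≤-trans (F-≤-suc (suc (length r))) (m≤m+n _ (valLow (d ∷ r))))

F≤valLow⇒¬000 : (z : List Bit) (j : ℕ) → length z ≡ 2 + j → No11 z → F (suc j) ≤ valLow z →
  ¬ BeginsWith (𝟎 ∷ 𝟎 ∷ 𝟎 ∷ []) (𝟎 ∷ z)
F≤valLow⇒¬000 .(𝟎 ∷ 𝟎 ∷ r) j |z| nz F≤ (r , refl) =
  <⇒≱ (subst (λ i → valLow r < F (suc i)) (suc-injective (suc-injective |z|)) (valLow<F r nz)) F≤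

φ^-valLow : (u : List Bit) → No11 u → φ^ (length u) (a ∷ []) [ valLow u ] ≡ just (letter (lastBit u))
φ^-valLow [] _ = refl
φ^-valLow (𝟎 ∷ u) nu = begin
  φ^ (suc (length u)) (a ∷ []) [ valLow u ]                 ≡⟨ cong (_[ valLow u ]) (φ^-suc-a (length u)) ⟩
  (φ^ (length u) (a ∷ []) ++ φ^ (length u) (b ∷ [])) [ valLow u ]
                                                            ≡⟨ []-++ˡ (φ^ (length u) (a ∷ [])) _ in-prefix ⟩
  φ^ (length u) (a ∷ []) [ valLow u ]                       ≡⟨ φ^-valLow u nu ⟩
  just (letter (lastBit u))                                 ≡⟨ cong (just ∘ letter) (lastBit-𝟎∷ u) ⟨
  just (letter (lastBit (𝟎 ∷ u)))                           ∎
  where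
  open ≡-Reasoning
  in-prefix : valLow u < length (φ^ (length u) (a ∷ []))
  in-prefix = subst (valLow u <_) (sym (length-φ^-a (length u))) (valLow<F u nu)
φ^-valLow (𝟏 ∷ []) _ = refl
φ^-valLow (𝟏 ∷ 𝟎 ∷ u) nu = begin
  φ^ (2 + length u) (a ∷ []) [ valLow (𝟏 ∷ 𝟎 ∷ u) ]        ≡⟨ cong₂ _[_] (φ^-suc-a (suc (length u))) past-prefix ⟩
  (A ++ φ^ (1 + length u) (b ∷ [])) [ length A + valLow u ] ≡⟨ []-++ʳ A _ (valLow u) ⟩
  φ^ (1 + length u) (b ∷ []) [ valLow u ]                   ≡⟨ cong (_[ valLow u ]) (φ^-suc-b (length u)) ⟩
  φ^ (length u) (a ∷ []) [ valLow u ]                       ≡⟨ φ^-valLow u nu ⟩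
  just (letter (lastBit u))                                 ≡⟨ cong (just ∘ letter) (lastBit-𝟎∷ u) ⟨
  just (letter (lastBit (𝟏 ∷ 𝟎 ∷ u)))                       ∎
  where
  open ≡-Reasoning
  A : List Letter
  A = φ^ (1 + length u) (a ∷ [])
  past-prefix : valLow (𝟏 ∷ 𝟎 ∷ u) ≡ length A + valLow u
  past-prefix = trans (valLow-𝟏 (𝟎 ∷ u)) (cong (_+ valLow u) (sym (length-φ^-a (suc (length u)))))

zeckendorf : (j t : ℕ) → t < F (suc j) → Σ (List Bit) λ z → length z ≡ j × No11 z × valLow z ≡ t
zeckendorf zero zero _ = [] , refl , tt , refl
zeckendorf zero (suc t) (s≤s ())
zeckendorf (suc zero) zero _ = 𝟎 ∷ [] , refl , tt , refl
zeckendorf (suc zero) (suc zero) _ = 𝟏 ∷ [] , refl , tt , refl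
zeckendorf (suc zero) (suc (suc t)) (s≤s (s≤s ()))
zeckendorf (suc (suc j)) t t< with t <? F (2 + j) | zeckendorf (suc j) t | zeckendorf j (t ∸ F (2 + j))
... | yes t<′ | zeckendorf-t | _ =
  let z , |z| , nz , vz = zeckendorf-t t<′ in 𝟎 ∷ z , cong suc |z| , nz , vz
... | no t≮ | _ | zeckendorf-t∸ =
  let z , |z| , nz , vz = zeckendorf-t∸ (m<n+o⇒m∸n<o t (F (2 + j)) {{>-nonZero (F-pos (suc j))}} t<)
  in 𝟏 ∷ 𝟎 ∷ z , cong (λ i → 2 + i) |z| , nz , (begin
    valLow (𝟏 ∷ 𝟎 ∷ z)              ≡⟨ valLow-𝟏 (𝟎 ∷ z) ⟩
    F (2 + length z) + valLow z     ≡⟨ cong₂ _+_ (cong (λ i → F (2 + i)) |z|) vz ⟩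
    F (2 + j) + (t ∸ F (2 + j))     ≡⟨ m+[n∸m]≡n (≮⇒≥ t≮) ⟩
    t                               ∎)
  where open ≡-Reasoning

valF-𝟎 : (u : List Bit) → valF (𝟎 ∷ u) ≡ + valLow u
valF-𝟎 u = ℤ.+-identityʳ (+ valLow u)

valF-𝟏 : (u : List Bit) → valF (𝟏 ∷ u) ≡ valLow u ⊖ F (length u)
valF-𝟏 u = trans (cong (λ f → + valLow u ℤ.- + f) (*-identityˡ (F (length u))))
                 (ℤ.[+m]-[+n]≡m⊖n (valLow u) (F (length u)))

m⊖[m+n]≡-n : (m n : ℕ) → m ⊖ (m + n) ≡ - + n
m⊖[m+n]≡-n m n = begin
  m ⊖ (m + n)       ≡⟨ cong (_⊖ (m + n)) (+-identityʳ m) ⟨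
  (m + 0) ⊖ (m + n) ≡⟨ ℤ.+-cancelˡ-⊖ m 0 n ⟩
  0 ⊖ n             ≡⟨ ℤ.⊖-≤ z≤n ⟩
  - + n             ∎
  where open ≡-Reasoning

valF≤valLow : (c : Bit) (u : List Bit) → valF (c ∷ u) ℤ.≤ + valLow u
valF≤valLow 𝟎 u = ℤ.≤-reflexive (valF-𝟎 u)
valF≤valLow 𝟏 u = subst (ℤ._≤ + valLow u) (sym (valF-𝟏 u)) (ℤ.m⊖n≤m (valLow u) (F (length u)))

-F≤valF : (c : Bit) (u : List Bit) → - + F (length u) ℤ.≤ valF (c ∷ u)
-F≤valF 𝟎 u = subst (- + F (length u) ℤ.≤_) (sym (valF-𝟎 u)) ℤ.neg-≤-pos
-F≤valF 𝟏 u = subst₂ ℤ._≤_ (ℤ.⊖-≤ z≤n) (sym (valF-𝟏 u)) (ℤ.⊖-monoˡ-≤ (F (length u)) z≤n)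

valF-100<-F : (r : List Bit) → No11 r → valF (𝟏 ∷ 𝟎 ∷ 𝟎 ∷ r) ℤ.< - + F (length r)
valF-100<-F r nr = begin-strict
  valF (𝟏 ∷ 𝟎 ∷ 𝟎 ∷ r)                 ≡⟨ valF-𝟏 (𝟎 ∷ 𝟎 ∷ r) ⟩
  valLow r ⊖ F (2 + length r)          <⟨ ℤ.⊖-monoˡ-< (F (2 + length r)) (valLow<F r nr) ⟩
  F (1 + length r) ⊖ F (2 + length r)  ≡⟨ m⊖[m+n]≡-n (F (1 + length r)) (F (length r)) ⟩
  - + F (length r)                      ∎
  where open ℤ.≤-Reasoning

valF∈I : (c : Bit) (u : List Bit) (k : ℕ) → length u ≡ 2 * k → No11 u → InI k (valF (c ∷ u))
valF∈I c u k |u| nu =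
  subst (λ j → - + F j ℤ.≤ valF (c ∷ u)) |u| (-F≤valF c u) ,
  ℤ.≤-<-trans (valF≤valLow c u) (+<+ (subst (λ j → valLow u < F (suc j)) |u| (valLow<F u nu)))

valF∉I : (w : List Bit) (k : ℕ) → length w ≡ 3 + 2 * k → No11 w →
  ¬ BeginsWith (𝟎 ∷ 𝟎 ∷ 𝟎 ∷ []) w → ¬ BeginsWith (𝟏 ∷ 𝟎 ∷ 𝟏 ∷ []) w → ¬ InI k (valF w)
valF∉I (𝟎 ∷ c ∷ d ∷ r) k |w| _ ¬000 _ (_ , w<F) = ℤ.<⇒≱ w<F (begin
  + F (suc (2 * k))    ≡⟨ cong (λ j → + F (suc j)) (suc-injective (suc-injective (suc-injective |w|))) ⟨
  + F (suc (length r)) ≤⟨ ℤ.+≤+ (F≤valLow c d r ¬000) ⟩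
  + valLow (c ∷ d ∷ r) ≡⟨ valF-𝟎 (c ∷ d ∷ r) ⟨
  valF (𝟎 ∷ c ∷ d ∷ r) ∎)
  where open ℤ.≤-Reasoning
valF∉I (𝟏 ∷ 𝟎 ∷ 𝟎 ∷ r) k |w| nw _ _ (-F≤w , _) = ℤ.<⇒≱
  (subst (λ j → valF (𝟏 ∷ 𝟎 ∷ 𝟎 ∷ r) ℤ.< - + F j) (suc-injective (suc-injective (suc-injective |w|)))
    (valF-100<-F r nw))
  -F≤w
valF∉I (𝟏 ∷ 𝟎 ∷ 𝟏 ∷ r) k _ _ _ ¬101 = ⊥-elim (¬101 (r , refl))

IsRepF-level : (w : List Bit) (k : ℕ) {n : ℤ} → IsRepF w n → length w ≡ 1 + 2 * k →
  InI k n × ¬ InIpred k n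
IsRepF-level (c ∷ u) k (_ , nw , ¬000 , ¬101 , refl) |w| =
  valF∈I c u k (suc-injective |w|) (No11-tail c u nw) , ∉Ipred k |w|
  where
  ∉Ipred : (k : ℕ) → length (c ∷ u) ≡ 1 + 2 * k → ¬ InIpred k (valF (c ∷ u))
  ∉Ipred zero _ = λ ()
  ∉Ipred (suc k) |w| = valF∉I (c ∷ u) k (trans |w| (cong suc (*-suc 2 k))) nw ¬000 ¬101

InI-mono : {i j : ℕ} {n : ℤ} → i ≤ j → InI i n → InI j n
InI-mono i≤j (-F≤n , n<F) =
  ℤ.≤-trans (ℤ.neg-mono-≤ (ℤ.+≤+ (F-mono-≤ (*-monoʳ-≤ 2 i≤j)))) -F≤n ,
  ℤ.<-≤-trans n<F (ℤ.+≤+ (F-mono-≤ (s≤s (*-monoʳ-≤ 2 i≤j))))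

level-unique : {i k : ℕ} {n : ℤ} → InI (suc k) n → ¬ InI k n → InI (suc i) n → ¬ InI i n → i ≡ k
level-unique {i} {k} n∈Iₖ₊₁ n∉Iₖ n∈Iᵢ₊₁ n∉Iᵢ with <-cmp i k
... | tri< i<k _ _ = ⊥-elim (n∉Iₖ (InI-mono i<k n∈Iᵢ₊₁))
... | tri≈ _ i≡k _ = i≡k
... | tri> _ _ k<i = ⊥-elim (n∉Iᵢ (InI-mono k<i n∈Iₖ₊₁))

BeginsWith-++ : (p v s : List Bit) → BeginsWith p v → BeginsWith p (v ++ s)
BeginsWith-++ p v s (r , refl) = r ++ s , ++-assoc p r s

IsRepF-prefix : (v s : List Bit) {n : ℤ} → IsRepF (v ++ s) n → Odd (length v) → IsRepF v (valF v)
IsRepF-prefix v s (_ , nvs , ¬000 , ¬101 , _) odd =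
  odd , No11-++⁻ˡ v s nvs , ¬000 ∘ BeginsWith-++ _ v s , ¬101 ∘ BeginsWith-++ _ v s , refl

h-suffix : (L : ℕ) (w : List Bit) → length w ≡ 2 + L → No11 w →
  Σ (List Bit) λ v → Σ (Fin 3) λ ℓ → w ≡ v ++ h ℓ × length v ≡ L
h-suffix zero (𝟎 ∷ 𝟎 ∷ []) _ _ = [] , zero , refl , refl
h-suffix zero (𝟎 ∷ 𝟏 ∷ []) _ _ = [] , suc zero , refl , refl
h-suffix zero (𝟏 ∷ 𝟎 ∷ []) _ _ = [] , suc (suc zero) , refl , refl
h-suffix (suc L) (c ∷ w) |w| nw with h-suffix L w (suc-injective |w|) (No11-tail c w nw)
... | v , ℓ , refl , |v| = c ∷ v , ℓ , refl , cong suc |v|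

representation-pos : (p : ℕ) → Σ ℕ λ k → Σ (List Bit) λ w → IsRepF w (+ suc p) × length w ≡ 3 + 2 * k
representation-pos p =
  let k , F≤1+p , 1+p<F = bracket (λ k → F (1 + 2 * k)) F-2*-<-odd (suc p) (s≤s z≤n)
      z , |z| , nz , vz = zeckendorf (2 + 2 * k) (suc p) (subst (λ j → suc p < F (suc j)) (*-suc 2 k) 1+p<F)
  in k , 𝟎 ∷ z ,
     ( subst Odd (cong suc (sym |z|)) (odd-1+2* k)
     , nz
     , F≤valLow⇒¬000 z (2 * k) |z| nz (subst (F (1 + 2 * k) ≤_) (sym vz) F≤1+p)
     , (λ { (_ , ()) })
     , trans (valF-𝟎 z) (cong +_ vz) )
     , cong suc |z|

representation-neg : (q : ℕ) → Σ ℕ λ k → Σ (List Bit) λ w → IsRepF w -[1+ suc q ] × length w ≡ 3 + 2 * k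
representation-neg q =
  let k , F≤1+q , 1+q<F = bracket (λ k → F (2 * k)) F-2*-<-even (suc q) (s≤s z≤n)
      T = F (2 + 2 * k)
      Q≤T : 2 + q ≤ T
      Q≤T = subst (λ j → 2 + q ≤ F j) (*-suc 2 k) 1+q<F
      T∸Q<F : T ∸ (2 + q) < F (1 + 2 * k)
      T∸Q<F = subst (T ∸ (2 + q) <_) (m+n∸n≡m (F (1 + 2 * k)) (F (2 * k))) (∸-monoʳ-< (s≤s F≤1+q) Q≤T)
      z , |z| , nz , vz = zeckendorf (2 * k) (T ∸ (2 + q)) T∸Q<F
  in k , 𝟏 ∷ 𝟎 ∷ 𝟎 ∷ z ,
     ( subst Odd (cong (λ i → 3 + i) (sym |z|)) (odd-1+2* k)
     , nz
     , (λ { (_ , ()) })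
     , (λ { (_ , ()) })
     , (begin
         valF (𝟏 ∷ 𝟎 ∷ 𝟎 ∷ z)        ≡⟨ valF-𝟏 (𝟎 ∷ 𝟎 ∷ z) ⟩
         valLow z ⊖ F (2 + length z) ≡⟨ cong₂ _⊖_ vz (cong (λ i → F (2 + i)) |z|) ⟩
         (T ∸ (2 + q)) ⊖ T           ≡⟨ ℤ.⊖-≤ (m∸n≤m T (2 + q)) ⟩
         - + (T ∸ (T ∸ (2 + q)))     ≡⟨ cong (λ i → - + i) (m∸[m∸n]≡n Q≤T) ⟩
         -[1+ suc q ]                ∎) )
     , cong (λ i → 3 + i) |z|
  where open ≡-Reasoning

representation : (n : ℤ) → ¬ InI 0 n → Σ ℕ λ k → Σ (List Bit) λ w → IsRepF w n × length w ≡ 3 + 2 * k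
representation (+ zero) n∉I₀ = ⊥-elim (n∉I₀ (ℤ.neg-≤-pos , +<+ (s≤s z≤n)))
representation (+ suc p) _ = representation-pos p
representation -[1+ zero ] n∉I₀ = ⊥-elim (n∉I₀ (-≤- z≤n , -<+))
representation -[1+ suc q ] _ = representation-neg q

φ²-lastBit : (v : List Bit) (ℓ : Fin 3) → No11 (v ++ h ℓ) →
  φ²ₗ (letter (lastBit v)) [ toℕ ℓ ] ≡ just (letter (lastBit (v ++ h ℓ)))
φ²-lastBit v zero _ rewrite lastBit-++ v 𝟎 𝟎 with lastBit v
... | 𝟎 = refl
... | 𝟏 = refl
φ²-lastBit v (suc zero) _ rewrite lastBit-++ v 𝟎 𝟏 with lastBit v
... | 𝟎 = refl
... | 𝟏 = refl
φ²-lastBit v (suc (suc zero)) nw rewrite lastBit-++ v 𝟏 𝟎 | No11⇒lastBit≡𝟎 v (𝟎 ∷ []) nw = refl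

module FixedWord (x : ℤ → Letter) (x-fixed : IsFixedWord x) where

  x-φ^-a : (j k t : ℕ) {c : Letter} → j ≡ 2 * k → φ^ j (a ∷ []) [ t ] ≡ just c → x (+ t) ≡ c
  x-φ^-a .(2 * k) k t refl eq with []≡just⇒lookup (φ^ (2 * k) (a ∷ [])) t eq
  ... | i , i≡t , refl = trans (cong (λ j → x (+ j)) (sym i≡t)) (proj₂ (x-fixed k) i)

  x-φ^-b : (j k t : ℕ) {c : Letter} → j ≡ 2 * k → φ^ j (b ∷ []) [ t ] ≡ just c → x (t ⊖ F j) ≡ c
  x-φ^-b .(2 * k) k t refl eq with []≡just⇒lookup (φ^ (2 * k) (b ∷ [])) t eq
  ... | i , i≡t , refl = trans (cong x (sym position)) (proj₁ (x-fixed k) i)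
    where
    position : + toℕ i ℤ.- + length (φ^ (2 * k) (b ∷ [])) ≡ t ⊖ F (2 * k)
    position = trans (ℤ.[+m]-[+n]≡m⊖n (toℕ i) (length (φ^ (2 * k) (b ∷ []))))
                     (cong₂ _⊖_ i≡t (length-φ^-b (2 * k)))

  x-valF : (w : List Bit) → Odd (length w) → No11 w → x (valF w) ≡ letter (lastBit w)
  x-valF (𝟎 ∷ u) odd nu with odd⇒1+2* (suc (length u)) odd
  ... | k , |w| = begin
    x (valF (𝟎 ∷ u))           ≡⟨ cong x (valF-𝟎 u) ⟩
    x (+ valLow u)              ≡⟨ x-φ^-a (length u) k (valLow u) (suc-injective |w|) (φ^-valLow u nu) ⟩
    letter (lastBit u)          ≡⟨ cong letter (lastBit-𝟎∷ u) ⟨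
    letter (lastBit (𝟎 ∷ u))   ∎
    where open ≡-Reasoning
  x-valF (𝟏 ∷ []) _ _ = x-φ^-b 0 0 0 refl refl
  x-valF (𝟏 ∷ 𝟎 ∷ u) odd nu with odd⇒1+2* (length u) odd
  ... | k , |u| = begin
    x (valF (𝟏 ∷ 𝟎 ∷ u))              ≡⟨ cong x (valF-𝟏 (𝟎 ∷ u)) ⟩
    x (valLow u ⊖ F (1 + length u))    ≡⟨ x-φ^-b (1 + length u) (suc k) (valLow u) 1+|u| φ^-b-valLow ⟩
    letter (lastBit u)                 ≡⟨ cong letter (lastBit-𝟎∷ u) ⟨
    letter (lastBit (𝟏 ∷ 𝟎 ∷ u))      ∎
    where
    open ≡-Reasoning
    1+|u| : 1 + length u ≡ 2 * suc k
    1+|u| = trans (cong suc |u|) (sym (*-suc 2 k))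
    φ^-b-valLow : φ^ (1 + length u) (b ∷ []) [ valLow u ] ≡ just (letter (lastBit u))
    φ^-b-valLow = trans (cong (_[ valLow u ]) (φ^-suc-b (length u))) (φ^-valLow u nu)

  x-rep : (w : List Bit) {n : ℤ} → IsRepF w n → x n ≡ letter (lastBit w)
  x-rep w (odd , nw , _ , _ , refl) = x-valF w odd nw

  x-rep-++-h : (v : List Bit) (ℓ : Fin 3) {m n : ℤ} → IsRepF v m → IsRepF (v ++ h ℓ) n →
    φ²ₗ (x m) [ toℕ ℓ ] ≡ just (x n)
  x-rep-++-h v ℓ {m} {n} v-rep w-rep = begin
    φ²ₗ (x m) [ toℕ ℓ ]                      ≡⟨ cong (λ c → φ²ₗ c [ toℕ ℓ ]) (x-rep v v-rep) ⟩
    φ²ₗ (letter (lastBit v)) [ toℕ ℓ ]       ≡⟨ φ²-lastBit v ℓ (proj₁ (proj₂ w-rep)) ⟩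
    just (letter (lastBit (v ++ h ℓ)))       ≡⟨ cong just (x-rep (v ++ h ℓ) w-rep) ⟨
    just (x n)                                ∎
    where open ≡-Reasoning

lemma3 : (x : ℤ → Letter) → IsFixedWord x →
    (n : ℤ) → ¬ InI 0 n →
    Σ ℤ λ m → Σ (Fin 3) λ ℓ →
    (φ²ₗ (x m) [ toℕ ℓ ] ≡ just (x n))
    × (Σ (List Bit) λ v → IsRepF v m × IsRepF (v ++ h ℓ) n)
    × ((i : ℕ) → InI (ℕ.suc i) n → ¬ InI i n → InI i m × ¬ InIpred i m)
lemma3 x x-fixed n n∉I₀ with representation n n∉I₀
... | k , w , w-rep , |w| with h-suffix (1 + 2 * k) w |w| (proj₁ (proj₂ w-rep))
... | v , ℓ , refl , |v| = valF v , ℓ , x-rep-++-h v ℓ v-rep w-rep , (v , v-rep , w-rep) , levels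
  where
  open FixedWord x x-fixed
  v-rep : IsRepF v (valF v)
  v-rep = IsRepF-prefix v (h ℓ) w-rep (subst Odd (sym |v|) (odd-1+2* k))
  n-level : InI (suc k) n × ¬ InI k n
  n-level = IsRepF-level (v ++ h ℓ) (suc k) w-rep (trans |w| (cong suc (sym (*-suc 2 k))))
  levels : (i : ℕ) → InI (suc i) n → ¬ InI i n → InI i (valF v) × ¬ InIpred i (valF v)
  levels i n∈Iᵢ₊₁ n∉Iᵢ with level-unique {i} {k} (proj₁ n-level) (proj₂ n-level) n∈Iᵢ₊₁ n∉Iᵢ
  ... | refl = IsRepF-level v k v-rep |v|
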